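{- Let $\lambda$ be a positive integer, let $a,b\in\{0,1,\dots,2\lambda\}$, and call a relation on a $k$-MOFS$(2\lambda)$ square-nontrivial if it is non-trivial on each of the columns $3,\dots,k+2$. Then: (i) there exists a $1$-MOFS$(2\lambda)$ with a square-nontrivial relation satisfying $|X_1|=a$, $|X_2|=b$ if and only if $a=b=\lambda$; (ii) there exists a $2$-MOFS$(2\lambda)$ with a square-nontrivial relation satisfying $|X_1|=a$, $|X_2|=b$ if and only if each of $\lambda,a,b$ is even and ($a=\lambda$ or $b=\lambda$); (iii) there exists a $3$-MOFS$(2\lambda)$ with a square-nontrivial relation satisfying $|X_1|=a$, $|X_2|=b$ if and only if each of $\lambda,a,b$ is even.
   Context: Let $N(n)=\{1,\dots,n\}$ and let $n$ be even. A (binary) frequency square of order $n$ is an $n\times n$ array indexed by $N(n)\times N(n)$ with entries in $\{0,1\}$ such that every row and every column contains exactly $n/2$ zeros and $n/2$ ones. Two frequency squares $F,G$ of order $n$ are orthogonal if for each $(a,b)\in\{0,1\}^2$ the number of cells $(r,c)$ with $(F[r,c],G[r,c])=(a,b)$ equals $n^2/4$. A $k$-MOFS$(n)$ is an ordered set $F_1,\dots,F_k$ of pairwise orthogonal frequency squares of order $n$. Relations: form the $n^2\times(k+2)$ array $\mathcal O$ having a row $(i,j,F_1[i,j],\dots,F_k[i,j])$ for each $(i,j)\in N(n)^2$. Let $Y_1=Y_2=N(n)$ and $Y_c=\{0,1\}$ for $3\le c\le k+2$. A relation is a tuple $(X_1,\dots,X_{k+2})$ with $X_c\subseteq Y_c$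 for all $c$ such that every row of $\mathcal O$ has an even number of positions $c$ for which the $c$-th entry of the row lies in $X_c$. A relation is trivial on column $c$ if $X_c=\emptyset$ or $X_c=Y_c$. Two relations $(X_1,\dots,X_{k+2})$, $(X'_1,\dots,X'_{k+2})$ are equivalent if $|X_i|=|X'_i|$ for all $i$. -}

module Defs where

open import Data.Nat using (ℕ; zero; suc; _+_; _*_)
open import Data.Nat.Divisibility using (_∣_)
open import Data.Bool using (Bool; true; false; if_then_else_; _∧_)
open import Data.Fin using (Fin; zero; suc; _≟_)
open import Data.Fin.Subset using (Subset; ∣_∣) renaming (⊥ to ∅; ⊤ to full)
open import Data.Vec using (lookup)
open import Data.Product using (Σ; _×_; _,_)
open import Relation.Nullary using (¬_)
open import Relation.Nullary.Decidable using (⌊_⌋)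
open import Relation.Binary.PropositionalEquality using (_≡_; _≢_)

ind : Bool → ℕ
ind true  = 1
ind false = 0

count : {n : ℕ} → (Fin n → Bool) → ℕ
count {zero}  p = 0
count {suc n} p = ind (p zero) + count (λ i → p (suc i))

sumFin : {k : ℕ} → (Fin k → ℕ) → ℕ
sumFin {zero}  f = 0
sumFin {suc k} f = f zero + sumFin (λ i → f (suc i))

count2 : {n : ℕ} → (Fin n → Fin n → Bool) → ℕ
count2 p = sumFin (λ r → count (λ c → p r c))

Square : ℕ → Set
Square n = Fin n → Fin n → Fin 2

_==_ : Fin 2 → Fin 2 → Bool
x == y = ⌊ x ≟ y ⌋

IsFrequencySquare : (l : ℕ) → Square (2 * l) → Set
IsFrequencySquare l F =
  ((r : Fin (2 * l)) → (s : Fin 2) → count (λ c → F r c == s) ≡ l) ×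
  ((c : Fin (2 * l)) → (s : Fin 2) → count (λ r → F r c == s) ≡ l)

Orthogonal : (l : ℕ) → Square (2 * l) → Square (2 * l) → Set
Orthogonal l F G =
  (s t : Fin 2) → count2 (λ r c → (F r c == s) ∧ (G r c == t)) ≡ l * l

record MOFS (k l : ℕ) : Set where
  field
    sq    : Fin k → Square (2 * l)
    freq  : (i : Fin k) → IsFrequencySquare l (sq i)
    ortho : (i j : Fin k) → i ≢ j → Orthogonal l (sq i) (sq j)

-- a relation (X₁ , X₂ , X₃ … X_{k+2}) on a k-MOFS(2l);
-- X₁, X₂ ⊆ N(2l), and Xs i ⊆ {0,1} is the subset for column i+3
record Relation {k l : ℕ} (M : MOFS k l) : Set where
  field
    X₁ : Subset (2 * l)
    X₂ : Subset (2 * l)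
    Xs : Fin k → Subset 2
    even : (r c : Fin (2 * l)) →
      2 ∣ (ind (lookup X₁ r) + ind (lookup X₂ c) +
           sumFin (λ i → ind (lookup (Xs i) (MOFS.sq M i r c))))

SquareNontrivial : {k l : ℕ} {M : MOFS k l} → Relation M → Set
SquareNontrivial {k} R = (i : Fin k) → (Relation.Xs R i ≢ ∅) × (Relation.Xs R i ≢ full)

HasRel : (k l a b : ℕ) → Set
HasRel k l a b = Σ (MOFS k l) (λ M → Σ (Relation M) (λ R →
  SquareNontrivial R × ∣ Relation.X₁ R ∣ ≡ a × ∣ Relation.X₂ R ∣ ≡ b))

-- A nontrivial subset of {0,1} is a single symbol, so a square-nontrivial relation says that the
-- indicator squares hᵢ of the chosen symbols satisfy h₁ ⊕ ⋯ ⊕ hₖ = x(r) ⊕ y(c), where x and y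
-- are the indicator vectors of X₁ and X₂.  Every hᵢ has l ones in each row and column, so each
-- line of hᵢ ⊕ hⱼ has an even number of ones, and orthogonality gives hᵢ ⊕ hⱼ 2l² ones in total.
-- For k = 1 a line of x(r) ⊕ y(c) has l ones, forcing |X₁| = |X₂| = l.  For k = 2 the lines give
-- |X₁| and |X₂| even, and the total gives |X₁|(2l − |X₂|) + (2l − |X₁|)|X₂| = 2l², that is
-- (|X₁| − l)(|X₂| − l) = 0.  For k = 3 the lines of h₃ give |X₁| ≡ |X₂| ≡ l (mod 2), and counting
-- the ones of (h₁ ⊕ h₂) ∧ y by rows gives l·|X₂| while counting them by columns gives an even
-- number, so l is even.
-- Conversely, the squares u(r) ⊕ w(c) built from balanced vectors u, w, with X₁ = ⊕ uᵢ,
-- X₂ = ⊕ wᵢ and X₃ = ⋯ = {1}, realize every remaining case: two such squares are orthogonal as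
-- soon as their u's (or their w's) take each pair of values equally often, and suitable vectors
-- are concatenations of constant blocks.
module Submission where

open import Defs
open import Algebra.Bundles using (CommutativeRing)
open import Data.Bool using (Bool; true; false; not; _xor_; _∧_; if_then_else_)
open import Data.Bool.Properties
  using ( not-involutive; not-distribˡ-xor; xor-same; xor-identityʳ; xor-comm; xor-assoc
        ; ∧-comm; ∧-identityʳ; ∧-zeroʳ; ∧-idem; xor-∧-commutativeRing)
open import Data.Empty using (⊥-elim)
open import Data.Fin using (Fin; zero; suc; cast; splitAt)
open import Data.Fin.Subset using (Subset; ⁅_⁆) renaming (∣_∣ to ∣_∣ₛ; ⊥ to ∅; ⊤ to full)
open import Data.List as List using (List; []; _∷_)
open import Data.Nat using (ℕ; zero; suc; _+_; _*_; _∸_; _≤_; _≤?_; NonZero)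
open import Data.Nat.Divisibility using (_∣_; divides)
open import Data.Nat.Properties
  using ( +-suc; +-assoc; +-identityʳ; *-comm; *-assoc; *-zeroʳ; *-distribˡ-+
        ; +-cancelˡ-≡; +-cancelʳ-≡; *-cancelˡ-≡; *-cancelˡ-≤
        ; m+[n∸m]≡n; m∸n+n≡m; m≤n+o⇒m∸n≤o; <⇒≤; ≰⇒>; +-commutativeSemigroup)
open import Data.Nat.Tactic.RingSolver using (solve-∀)
open import Data.Product using (Σ; _×_; _,_; proj₁; proj₂; map₂)
open import Data.Sum using (_⊎_; inj₁; inj₂; [_,_])
open import Data.Sum.Properties using ([,]-map)
open import Data.Vec using ([]; _∷_; lookup; tabulate)
open import Data.Vec.Properties using (lookup∘tabulate)
open import Data.Vec.Functional using (Vector; replicate) renaming (_++_ to _++ᵛ_; [] to []ᵛ)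
open import Function.Bundles using (_⇔_; mk⇔)
open import Relation.Nullary using (yes; no)
open import Relation.Binary.PropositionalEquality
  using (_≡_; _≢_; refl; sym; trans; cong; cong₂; subst; subst₂; module ≡-Reasoning)
open import Algebra.Properties.CommutativeSemigroup +-commutativeSemigroup
  using () renaming (interchange to +-interchange)
open import Algebra.Properties.CommutativeSemigroup
  (CommutativeRing.+-commutativeSemigroup xor-∧-commutativeRing)
  using () renaming (interchange to xor-interchange; x∙yz≈y∙xz to xor-x∙yz≈y∙xz)

-- Parity

par : ℕ → Bool
par zero    = false
par (suc n) = not (par n)

par-+ : ∀ m n → par (m + n) ≡ par m xor par n
par-+ zero    n = refl
par-+ (suc m) n = trans (cong not (par-+ m n)) (not-distribˡ-xor (par m) (par n))

par-* : ∀ m n → par (m * n) ≡ par m ∧ par n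
par-* zero    n = refl
par-* (suc m) n = trans (par-+ n (m * n)) (trans (cong (par n xor_) (par-* m n)) (absorb (par m) (par n)))
  where
  absorb : ∀ x y → y xor (x ∧ y) ≡ not x ∧ y
  absorb true  y = xor-same y
  absorb false y = xor-identityʳ y

par-ind : ∀ b → par (ind b) ≡ b
par-ind true  = refl
par-ind false = refl

∣⇒par≡false : ∀ {n} → 2 ∣ n → par n ≡ false
∣⇒par≡false (divides q refl) = trans (par-* q 2) (∧-zeroʳ (par q))

par≡false⇒∣ : ∀ n → par n ≡ false → 2 ∣ n
par≡false⇒∣ zero          _  = divides 0 refl
par≡false⇒∣ (suc zero)    ()
par≡false⇒∣ (suc (suc n)) eq with par≡false⇒∣ n (trans (sym (not-involutive (par n))) eq)
... | divides q refl = divides (suc q) refl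

xor≡false⇒≡ : ∀ {x y} → x xor y ≡ false → y ≡ x
xor≡false⇒≡ {true}  {true}  _ = refl
xor≡false⇒≡ {false} {false} _ = refl

xor-solve : ∀ {x y z} → x xor y ≡ z → y ≡ x xor z
xor-solve {false} eq = eq
xor-solve {true} {true}  refl = refl
xor-solve {true} {false} refl = refl

xorAll : ∀ {n} → (Fin n → Bool) → Bool
xorAll {zero}  p = false
xorAll {suc n} p = p zero xor xorAll (λ i → p (suc i))

xorAll-xor : ∀ {n} (p q : Fin n → Bool) → xorAll (λ i → p i xor q i) ≡ xorAll p xor xorAll q
xorAll-xor {zero}  p q = refl
xorAll-xor {suc n} p q =
  trans (cong ((p zero xor q zero) xor_) (xorAll-xor (λ i → p (suc i)) (λ i → q (suc i))))
        (xor-interchange (p zero) (q zero) _ _)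

par-sumFin-ind : ∀ {n} (p : Fin n → Bool) → par (sumFin (λ i → ind (p i))) ≡ xorAll p
par-sumFin-ind {zero}  p = refl
par-sumFin-ind {suc n} p =
  trans (par-+ (ind (p zero)) _) (cong₂ _xor_ (par-ind (p zero)) (par-sumFin-ind (λ i → p (suc i))))

par-relation : ∀ {k} a b (p : Fin k → Bool) →
  par (ind a + ind b + sumFin (λ i → ind (p i))) ≡ (a xor b) xor xorAll p
par-relation a b p = begin
  par (ind a + ind b + sumFin (λ i → ind (p i)))
    ≡⟨ par-+ (ind a + ind b) _ ⟩
  par (ind a + ind b) xor par (sumFin (λ i → ind (p i)))
    ≡⟨ cong₂ _xor_ (par-+ (ind a) (ind b)) (par-sumFin-ind p) ⟩
  (par (ind a) xor par (ind b)) xor xorAll p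
    ≡⟨ cong (_xor xorAll p) (cong₂ _xor_ (par-ind a) (par-ind b)) ⟩
  (a xor b) xor xorAll p ∎
  where open ≡-Reasoning

par-sumFin-even : ∀ {n} (f : Fin n → ℕ) → (∀ i → par (f i) ≡ false) → par (sumFin f) ≡ false
par-sumFin-even {zero}  f _    = refl
par-sumFin-even {suc n} f even =
  trans (par-+ (f zero) _) (cong₂ _xor_ (even zero) (par-sumFin-even (λ i → f (suc i)) (λ i → even (suc i))))

-- Counting

sumFin-cong : ∀ {n} {f g : Fin n → ℕ} → (∀ i → f i ≡ g i) → sumFin f ≡ sumFin g
sumFin-cong {zero}  _  = refl
sumFin-cong {suc n} eq = cong₂ _+_ (eq zero) (sumFin-cong (λ i → eq (suc i)))

sumFin-+ : ∀ {n} (f g : Fin n → ℕ) → sumFin (λ i → f i + g i) ≡ sumFin f + sumFin g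
sumFin-+ {zero}  f g = refl
sumFin-+ {suc n} f g =
  trans (cong (f zero + g zero +_) (sumFin-+ (λ i → f (suc i)) (λ i → g (suc i))))
        (+-interchange (f zero) (g zero) _ _)

sumFin-const : ∀ {n} k → sumFin {n} (λ _ → k) ≡ n * k
sumFin-const {zero}  k = refl
sumFin-const {suc n} k = cong (k +_) (sumFin-const {n} k)

sumFin-swap : ∀ {m n} (f : Fin m → Fin n → ℕ) →
  sumFin (λ r → sumFin (λ c → f r c)) ≡ sumFin (λ c → sumFin (λ r → f r c))
sumFin-swap {zero}  {n} f = sym (trans (sumFin-const {n} 0) (*-zeroʳ n))
sumFin-swap {suc m} f =
  trans (cong (sumFin (f zero) +_) (sumFin-swap (λ r c → f (suc r) c)))
        (sym (sumFin-+ (f zero) (λ c → sumFin (λ r → f (suc r) c))))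

sumFin-if : ∀ {n} (p : Fin n → Bool) k → sumFin (λ i → if p i then k else 0) ≡ count p * k
sumFin-if {zero}  p k = refl
sumFin-if {suc n} p k with p zero
... | true  = cong (k +_) (sumFin-if (λ i → p (suc i)) k)
... | false = sumFin-if (λ i → p (suc i)) k

sumFin-combine : ∀ {n} {f g h k : Fin n → ℕ} → (∀ i → f i + 2 * g i ≡ h i + k i) →
  sumFin f + 2 * sumFin g ≡ sumFin h + sumFin k
sumFin-combine {zero}  _  = refl
sumFin-combine {suc n} {f} {g} {h} {k} eq = begin
  (f zero + F) + 2 * (g zero + G)      ≡⟨ regroup (f zero) F (g zero) G ⟩
  (f zero + 2 * g zero) + (F + 2 * G)  ≡⟨ cong₂ _+_ (eq zero) (sumFin-combine (λ i → eq (suc i))) ⟩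
  (h zero + k zero) + (H + K)          ≡⟨ +-interchange (h zero) (k zero) H K ⟩
  (h zero + H) + (k zero + K)          ∎
  where
  open ≡-Reasoning
  F = sumFin (λ i → f (suc i))
  G = sumFin (λ i → g (suc i))
  H = sumFin (λ i → h (suc i))
  K = sumFin (λ i → k (suc i))
  regroup : ∀ a b c d → (a + b) + 2 * (c + d) ≡ (a + 2 * c) + (b + 2 * d)
  regroup = solve-∀

count-cong : ∀ {n} {p q : Fin n → Bool} → (∀ i → p i ≡ q i) → count p ≡ count q
count-cong {zero}  _  = refl
count-cong {suc n} eq = cong₂ _+_ (cong ind (eq zero)) (count-cong (λ i → eq (suc i)))

count-sum : ∀ {n} (p : Fin n → Bool) → count p ≡ sumFin (λ i → ind (p i))
count-sum {zero}  p = refl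
count-sum {suc n} p = cong (ind (p zero) +_) (count-sum (λ i → p (suc i)))

count-const : ∀ {n} b → count {n} (λ _ → b) ≡ (if b then n else 0)
count-const {zero}  true  = refl
count-const {zero}  false = refl
count-const {suc n} true  = cong suc (count-const {n} true)
count-const {suc n} false = count-const {n} false

count-∧ˡ : ∀ {n} b (p : Fin n → Bool) → count (λ i → b ∧ p i) ≡ (if b then count p else 0)
count-∧ˡ true  p = refl
count-∧ˡ {n} false p = count-const {n} false

count-not : ∀ {n} (p : Fin n → Bool) → count p + count (λ i → not (p i)) ≡ n
count-not {zero}  p = refl
count-not {suc n} p with p zero
... | true  = cong suc (count-not (λ i → p (suc i)))
... | false = trans (+-suc _ _) (cong suc (count-not (λ i → p (suc i))))

count-xor : ∀ {n} (p q : Fin n → Bool) →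
  count (λ i → p i xor q i) + 2 * count (λ i → p i ∧ q i) ≡ count p + count q
count-xor p q = begin
  count (λ i → p i xor q i) + 2 * count (λ i → p i ∧ q i)
    ≡⟨ cong₂ (λ s t → s + 2 * t) (count-sum (λ i → p i xor q i)) (count-sum (λ i → p i ∧ q i)) ⟩
  sumFin (λ i → ind (p i xor q i)) + 2 * sumFin (λ i → ind (p i ∧ q i))
    ≡⟨ sumFin-combine (λ i → ind-xor (p i) (q i)) ⟩
  sumFin (λ i → ind (p i)) + sumFin (λ i → ind (q i))
    ≡⟨ sym (cong₂ _+_ (count-sum p) (count-sum q)) ⟩
  count p + count q ∎
  where
  open ≡-Reasoning
  ind-xor : ∀ x y → ind (x xor y) + 2 * ind (x ∧ y) ≡ ind x + ind y
  ind-xor true  true  = refl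
  ind-xor true  false = refl
  ind-xor false true  = refl
  ind-xor false false = refl

par-count : ∀ {n} (p : Fin n → Bool) → par (count p) ≡ xorAll p
par-count p = trans (cong par (count-sum p)) (par-sumFin-ind p)

par-count-xor : ∀ {n} (p q : Fin n → Bool) →
  par (count (λ i → p i xor q i)) ≡ par (count p) xor par (count q)
par-count-xor p q = begin
  par (count (λ i → p i xor q i))  ≡⟨ par-count (λ i → p i xor q i) ⟩
  xorAll (λ i → p i xor q i)       ≡⟨ xorAll-xor p q ⟩
  xorAll p xor xorAll q            ≡⟨ sym (cong₂ _xor_ (par-count p) (par-count q)) ⟩
  par (count p) xor par (count q)  ∎
  where open ≡-Reasoning

count2-cong : ∀ {n} {P Q : Fin n → Fin n → Bool} → (∀ r c → P r c ≡ Q r c) → count2 P ≡ count2 Q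
count2-cong eq = sumFin-cong (λ r → count-cong (eq r))

count2-transpose : ∀ {n} (P : Fin n → Fin n → Bool) → count2 P ≡ count2 (λ c r → P r c)
count2-transpose P = begin
  sumFin (λ r → count (P r))                    ≡⟨ sumFin-cong (λ r → count-sum (P r)) ⟩
  sumFin (λ r → sumFin (λ c → ind (P r c)))     ≡⟨ sumFin-swap (λ r c → ind (P r c)) ⟩
  sumFin (λ c → sumFin (λ r → ind (P r c)))     ≡⟨ sumFin-cong (λ c → sym (count-sum (λ r → P r c))) ⟩
  sumFin (λ c → count (λ r → P r c))            ∎
  where open ≡-Reasoning

count2-rows : ∀ {n} k (P : Fin n → Fin n → Bool) → (∀ r → count (P r) ≡ k) → count2 P ≡ n * k
count2-rows {n} k P rows = trans (sumFin-cong rows) (sumFin-const {n} k)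

count2-xor : ∀ {n} (P Q : Fin n → Fin n → Bool) →
  count2 (λ r c → P r c xor Q r c) + 2 * count2 (λ r c → P r c ∧ Q r c) ≡ count2 P + count2 Q
count2-xor P Q = sumFin-combine (λ r → count-xor (P r) (Q r))

count2-∧ : ∀ {n} (p q : Fin n → Bool) → count2 (λ r c → p r ∧ q c) ≡ count p * count q
count2-∧ p q = trans (sumFin-cong (λ r → count-∧ˡ (p r) q)) (sumFin-if p (count q))

j+[j′+0]≡j+j′ : ∀ j j′ → j + (j′ + 0) ≡ j + j′
j+[j′+0]≡j+j′ j j′ = cong (j +_) (+-identityʳ j′)

2*l≡l+l : ∀ l → 2 * l ≡ l + l
2*l≡l+l l = j+[j′+0]≡j+j′ l l

balanced-not : ∀ {l} (p : Fin (2 * l) → Bool) → count p ≡ l → count (λ i → not (p i)) ≡ l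
balanced-not {l} p eq =
  +-cancelˡ-≡ l _ _ (trans (cong (_+ count (λ i → not (p i))) (sym eq))
                          (trans (count-not p) (2*l≡l+l l)))

balanced-xor : ∀ {l} b (p : Fin (2 * l) → Bool) → count p ≡ l → count (λ i → b xor p i) ≡ l
balanced-xor false p eq = eq
balanced-xor true  p eq = balanced-not p eq

balanced-xor⁻¹ : ∀ {l} b (p : Fin (2 * l) → Bool) → count (λ i → b xor p i) ≡ l → count p ≡ l
balanced-xor⁻¹ false p eq = eq
balanced-xor⁻¹ true  p eq = trans (count-cong (λ i → sym (not-involutive (p i)))) (balanced-not _ eq)

par-count-xor-const : ∀ {l} b (p : Fin (2 * l) → Bool) → par (count (λ i → b xor p i)) ≡ par (count p)
par-count-xor-const {l} b p = trans (par-count-xor (λ _ → b) p) (cong (_xor par (count p)) (even b))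
  where
  even : ∀ b → par (count {2 * l} (λ _ → b)) ≡ false
  even true  = trans (cong par (count-const {2 * l} true)) (par-* 2 l)
  even false = cong par (count-const {2 * l} false)

card-lookup : ∀ {n} (X : Subset n) → ∣ X ∣ₛ ≡ count (lookup X)
card-lookup []          = refl
card-lookup (true ∷ X)  = cong suc (card-lookup X)
card-lookup (false ∷ X) = card-lookup X

card-tabulate : ∀ {n} (p : Fin n → Bool) → ∣ tabulate p ∣ₛ ≡ count p
card-tabulate p = trans (card-lookup (tabulate p)) (count-cong (lookup∘tabulate p))

-- Necessity

nontrivial-singleton : (X : Subset 2) → X ≢ ∅ → X ≢ full →
  Σ (Fin 2) λ s → ∀ v → lookup X v ≡ (v == s)
nontrivial-singleton (false ∷ false ∷ []) X≢∅ _ = ⊥-elim (X≢∅ refl)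
nontrivial-singleton (true ∷ true ∷ [])   _ X≢full = ⊥-elim (X≢full refl)
nontrivial-singleton (true ∷ false ∷ [])  _ _ = zero , λ { zero → refl ; (suc zero) → refl }
nontrivial-singleton (false ∷ true ∷ [])  _ _ = suc zero , λ { zero → refl ; (suc zero) → refl }

module _ where
  -- Kept local: the integer +_ would clash with sections such as (l +_).
  open import Data.Integer as ℤ using (+_; _-_; 0ℤ)
  open import Data.Integer.Properties
    using (pos-+; pos-*; +-injective; i≡j⇒i-j≡0; i-j≡0⇒i≡j; i*j≡0⇒i≡0∨j≡0)
  open import Data.Integer.Tactic.RingSolver using () renaming (solve-∀ to solve-∀ᶻ)

  a≡l⊎b≡l : ∀ l a b → l * l + a * b ≡ l * a + l * b → a ≡ l ⊎ b ≡ l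
  a≡l⊎b≡l l a b eq with i*j≡0⇒i≡0∨j≡0 (+ a - + l) product≡0
    where
    open ≡-Reasoning
    toℤ : ∀ w x y z → + (w * x + y * z) ≡ + w ℤ.* + x ℤ.+ + y ℤ.* + z
    toℤ w x y z = trans (pos-+ (w * x) (y * z)) (cong₂ ℤ._+_ (pos-* w x) (pos-* y z))
    expand : ∀ A B L → (A - L) ℤ.* (B - L) ≡ (L ℤ.* L ℤ.+ A ℤ.* B) - (L ℤ.* A ℤ.+ L ℤ.* B)
    expand = solve-∀ᶻ
    product≡0 : (+ a - + l) ℤ.* (+ b - + l) ≡ 0ℤ
    product≡0 = begin
      (+ a - + l) ℤ.* (+ b - + l)                  ≡⟨ expand (+ a) (+ b) (+ l) ⟩
      (+ l ℤ.* + l ℤ.+ + a ℤ.* + b) - (+ l ℤ.* + a ℤ.+ + l ℤ.* + b)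
        ≡⟨ sym (cong₂ _-_ (toℤ l l a b) (toℤ l a l b)) ⟩
      + (l * l + a * b) - + (l * a + l * b)        ≡⟨ i≡j⇒i-j≡0 (cong +_ eq) ⟩
      0ℤ                                            ∎
  ... | inj₁ a-l≡0 = inj₁ (+-injective (i-j≡0⇒i≡j _ _ a-l≡0))
  ... | inj₂ b-l≡0 = inj₂ (+-injective (i-j≡0⇒i≡j _ _ b-l≡0))

count2-xor-outer : ∀ {n} (p q : Fin n → Bool) →
  count2 (λ r c → p r xor q c) + 2 * (count p * count q) ≡ count p * n + n * count q
count2-xor-outer {n} p q = begin
  count2 (λ r c → p r xor q c) + 2 * (count p * count q)
    ≡⟨ cong (λ t → count2 (λ r c → p r xor q c) + 2 * t) (sym (count2-∧ p q)) ⟩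
  count2 (λ r c → p r xor q c) + 2 * count2 (λ r c → p r ∧ q c)
    ≡⟨ count2-xor (λ r c → p r) (λ r c → q c) ⟩
  count2 (λ r c → p r) + count2 (λ r c → q c)
    ≡⟨ cong₂ _+_ rows-of-p (count2-rows (count q) (λ r c → q c) (λ r → refl)) ⟩
  count p * n + n * count q
    ∎
  where
  open ≡-Reasoning
  rows-of-p : count2 (λ r c → p r) ≡ count p * n
  rows-of-p = trans (count2-cong (λ r c → sym (∧-identityʳ (p r))))
                    (trans (count2-∧ p (λ _ → true)) (cong (count p *_) (count-const {n} true)))

outer-xor-balanced : ∀ {l} (x y : Fin (2 * l) → Bool) →
  count2 (λ r c → x r xor y c) ≡ 2 * (l * l) → count x ≡ l ⊎ count y ≡ l
outer-xor-balanced {l} x y total = a≡l⊎b≡l l a b (*-cancelˡ-≡ _ _ 2 (begin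
  2 * (l * l + a * b)                          ≡⟨ *-distribˡ-+ 2 (l * l) (a * b) ⟩
  2 * (l * l) + 2 * (a * b)                    ≡⟨ cong (_+ 2 * (a * b)) total ⟨
  count2 (λ r c → x r xor y c) + 2 * (a * b)   ≡⟨ count2-xor-outer x y ⟩
  a * (2 * l) + 2 * l * b                      ≡⟨ regroup l a b ⟩
  2 * (l * a + l * b)                          ∎))
  where
  open ≡-Reasoning
  a = count x
  b = count y
  regroup : ∀ l a b → a * (2 * l) + 2 * l * b ≡ 2 * (l * a + l * b)
  regroup = solve-∀

par-count-xor-even : ∀ {n l} (p q : Fin n → Bool) →
  count (λ i → p i xor q i) ≡ l → par (count p) ≡ false → par (count q) ≡ par l
par-count-xor-even {l = l} p q count≡l p-even = begin
  par (count q)                          ≡⟨ cong (_xor par (count q)) p-even ⟨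
  par (count p) xor par (count q)        ≡⟨ par-count-xor p q ⟨
  par (count (λ i → p i xor q i))        ≡⟨ cong par count≡l ⟩
  par l                                  ∎
  where open ≡-Reasoning

double-count-parity : ∀ {l} (H : Fin (2 * l) → Fin (2 * l) → Bool) (y : Fin (2 * l) → Bool) →
  count2 H ≡ 2 * (l * l) → (∀ r → count (λ c → H r c xor y c) ≡ l) →
  (∀ c → par (count (λ r → H r c)) ≡ false) → par (l * count y) ≡ false
double-count-parity {l} H y total rows columns-even = begin
  par (l * count y)  ≡⟨ cong par by-rows ⟨
  par E              ≡⟨ cong par (count2-transpose (λ r c → H r c ∧ y c)) ⟩
  par (sumFin (λ c → count (λ r → H r c ∧ y c)))
                     ≡⟨ par-sumFin-even _ by-columns ⟩
  false              ∎
  where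
  open ≡-Reasoning
  E : ℕ
  E = count2 (λ r c → H r c ∧ y c)
  by-rows : E ≡ l * count y
  by-rows = *-cancelˡ-≡ _ _ 2 (+-cancelˡ-≡ (2 * (l * l)) _ _ (begin
    2 * (l * l) + 2 * E                        ≡⟨ cong (_+ 2 * E) (*-assoc 2 l l) ⟨
    2 * l * l + 2 * E                          ≡⟨ cong (_+ 2 * E) (count2-rows l (λ r c → H r c xor y c) rows) ⟨
    count2 (λ r c → H r c xor y c) + 2 * E     ≡⟨ count2-xor H (λ r c → y c) ⟩
    count2 H + count2 (λ r c → y c)            ≡⟨ cong₂ _+_ total (count2-rows (count y) (λ r c → y c) (λ r → refl)) ⟩
    2 * (l * l) + 2 * l * count y              ≡⟨ cong (2 * (l * l) +_) (*-assoc 2 l (count y)) ⟩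
    2 * (l * l) + 2 * (l * count y)            ∎))
  by-columns : ∀ c → par (count (λ r → H r c ∧ y c)) ≡ false
  by-columns c with y c
  ... | true  = trans (cong par (count-cong (λ r → ∧-identityʳ (H r c)))) (columns-even c)
  ... | false = trans (cong par (count-cong (λ r → ∧-zeroʳ (H r c)))) (cong par (count-const {2 * l} false))

module IndicatorSquares {k l} (M : MOFS k l) (R : Relation M) (nt : SquareNontrivial R) where
  open MOFS M
  open Relation R

  singleton : ∀ i → Σ (Fin 2) λ s → ∀ v → lookup (Xs i) v ≡ (v == s)
  singleton i = nontrivial-singleton (Xs i) (proj₁ (nt i)) (proj₂ (nt i))

  h : Fin k → Fin (2 * l) → Fin (2 * l) → Bool
  h i r c = sq i r c == proj₁ (singleton i)

  x y : Fin (2 * l) → Bool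
  x = lookup X₁
  y = lookup X₂

  h-row : ∀ i r → count (λ c → h i r c) ≡ l
  h-row i r = proj₁ (freq i) r (proj₁ (singleton i))

  h-col : ∀ i c → count (λ r → h i r c) ≡ l
  h-col i c = proj₂ (freq i) c (proj₁ (singleton i))

  h-relation : ∀ r c → xorAll (λ i → h i r c) ≡ x r xor y c
  h-relation r c = xor≡false⇒≡ (begin
    (x r xor y c) xor xorAll (λ i → h i r c)
      ≡⟨ par-relation (x r) (y c) (λ i → h i r c) ⟨
    par (ind (x r) + ind (y c) + sumFin (λ i → ind (h i r c)))
      ≡⟨ cong (λ t → par (ind (x r) + ind (y c) + t))
              (sumFin-cong (λ i → cong ind (proj₂ (singleton i) (sq i r c)))) ⟨
    par (ind (x r) + ind (y c) + sumFin (λ i → ind (lookup (Xs i) (sq i r c))))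
      ≡⟨ ∣⇒par≡false (even r c) ⟩
    false ∎)
    where open ≡-Reasoning

  h-xor-row-even : ∀ i j r → par (count (λ c → h i r c xor h j r c)) ≡ false
  h-xor-row-even i j r =
    trans (par-count-xor (h i r) (h j r))
          (trans (cong₂ (λ s t → par s xor par t) (h-row i r) (h-row j r)) (xor-same (par l)))

  h-xor-col-even : ∀ i j c → par (count (λ r → h i r c xor h j r c)) ≡ false
  h-xor-col-even i j c =
    trans (par-count-xor (λ r → h i r c) (λ r → h j r c))
          (trans (cong₂ (λ s t → par s xor par t) (h-col i c) (h-col j c)) (xor-same (par l)))

  h-xor-total : ∀ i j → i ≢ j → count2 (λ r c → h i r c xor h j r c) ≡ 2 * (l * l)
  h-xor-total i j i≢j = +-cancelʳ-≡ (2 * (l * l)) _ _ (begin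
    count2 (λ r c → h i r c xor h j r c) + 2 * (l * l)
      ≡⟨ cong (λ t → count2 (λ r c → h i r c xor h j r c) + 2 * t) (ortho i j i≢j _ _) ⟨
    count2 (λ r c → h i r c xor h j r c) + 2 * count2 (λ r c → h i r c ∧ h j r c)
      ≡⟨ count2-xor (h i) (h j) ⟩
    count2 (h i) + count2 (h j)
      ≡⟨ cong₂ _+_ (count2-rows l (h i) (h-row i)) (count2-rows l (h j) (h-row j)) ⟩
    2 * l * l + 2 * l * l
      ≡⟨ cong (λ t → t + t) (*-assoc 2 l l) ⟩
    2 * (l * l) + 2 * (l * l)
      ∎)
    where open ≡-Reasoning

  card-X₁ : ∣ X₁ ∣ₛ ≡ count x
  card-X₁ = card-lookup X₁

  card-X₂ : ∣ X₂ ∣ₛ ≡ count y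
  card-X₂ = card-lookup X₂

necessary₁ : ∀ {l a b} → Fin (2 * l) → HasRel 1 l a b → a ≡ l × b ≡ l
necessary₁ {l} r₀ (M , R , nt , refl , refl) = trans card-X₁ x-balanced , trans card-X₂ y-balanced
  where
  open IndicatorSquares M R nt
  square : ∀ r c → h zero r c ≡ x r xor y c
  square r c = trans (sym (xor-identityʳ _)) (h-relation r c)
  y-balanced : count y ≡ l
  y-balanced = balanced-xor⁻¹ (x r₀) y (trans (count-cong (λ c → sym (square r₀ c))) (h-row zero r₀))
  x-balanced : count x ≡ l
  x-balanced = balanced-xor⁻¹ (y r₀) x
    (trans (count-cong (λ r → trans (xor-comm (y r₀) (x r)) (sym (square r r₀)))) (h-col zero r₀))

necessary₂ : ∀ {l a b} → Fin (2 * l) → HasRel 2 l a b → (2 ∣ l × 2 ∣ a × 2 ∣ b) × (a ≡ l ⊎ b ≡ l)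
necessary₂ {l} r₀ (M , R , nt , refl , refl)
  rewrite IndicatorSquares.card-X₁ M R nt | IndicatorSquares.card-X₂ M R nt =
  (l-even , a-even , b-even) , one-is-l
  where
  open IndicatorSquares M R nt
  H : Fin (2 * l) → Fin (2 * l) → Bool
  H r c = h zero r c xor h (suc zero) r c
  square : ∀ r c → H r c ≡ x r xor y c
  square r c = trans (cong (h zero r c xor_) (sym (xor-identityʳ _))) (h-relation r c)
  b-even : 2 ∣ count y
  b-even = par≡false⇒∣ (count y) (trans (sym (par-count-xor-const {l} (x r₀) y))
    (trans (cong par (count-cong (λ c → sym (square r₀ c)))) (h-xor-row-even zero (suc zero) r₀)))
  a-even : 2 ∣ count x
  a-even = par≡false⇒∣ (count x) (trans (sym (par-count-xor-const {l} (y r₀) x))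
    (trans (cong par (count-cong (λ r → trans (xor-comm (y r₀) (x r)) (sym (square r r₀)))))
           (h-xor-col-even zero (suc zero) r₀)))
  one-is-l : count x ≡ l ⊎ count y ≡ l
  one-is-l = outer-xor-balanced x y (trans (sym (count2-cong square)) (h-xor-total zero (suc zero) (λ ())))
  l-even : 2 ∣ l
  l-even = [ (λ a≡l → subst (2 ∣_) a≡l a-even) , (λ b≡l → subst (2 ∣_) b≡l b-even) ] one-is-l

necessary₃ : ∀ {l a b} → Fin (2 * l) → HasRel 3 l a b → 2 ∣ l × 2 ∣ a × 2 ∣ b
necessary₃ {l} r₀ (M , R , nt , refl , refl)
  rewrite IndicatorSquares.card-X₁ M R nt | IndicatorSquares.card-X₂ M R nt =
  par≡false⇒∣ l l-even ,
  par≡false⇒∣ (count x) (trans x-parity l-even) ,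
  par≡false⇒∣ (count y) (trans y-parity l-even)
  where
  open IndicatorSquares M R nt
  open ≡-Reasoning
  H : Fin (2 * l) → Fin (2 * l) → Bool
  H r c = h zero r c xor h (suc zero) r c
  third : ∀ r c → h (suc (suc zero)) r c ≡ H r c xor (x r xor y c)
  third r c = xor-solve {H r c} (begin
    H r c xor h (suc (suc zero)) r c
      ≡⟨ xor-assoc (h zero r c) (h (suc zero) r c) _ ⟩
    h zero r c xor (h (suc zero) r c xor h (suc (suc zero)) r c)
      ≡⟨ cong (λ t → h zero r c xor (h (suc zero) r c xor t)) (xor-identityʳ _) ⟨
    xorAll (λ i → h i r c)
      ≡⟨ h-relation r c ⟩
    x r xor y c ∎)
  Hy-row : ∀ r → count (λ c → H r c xor y c) ≡ l
  Hy-row r = balanced-xor⁻¹ (x r) (λ c → H r c xor y c)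
    (trans (count-cong (λ c → trans (xor-x∙yz≈y∙xz (x r) (H r c) (y c)) (sym (third r c))))
           (h-row (suc (suc zero)) r))
  Hx-col : ∀ c → count (λ r → H r c xor x r) ≡ l
  Hx-col c = balanced-xor⁻¹ (y c) (λ r → H r c xor x r)
    (trans (count-cong (λ r → trans (xor-x∙yz≈y∙xz (y c) (H r c) (x r))
                                    (trans (cong (H r c xor_) (xor-comm (y c) (x r))) (sym (third r c)))))
           (h-col (suc (suc zero)) c))
  y-parity : par (count y) ≡ par l
  y-parity = par-count-xor-even (H r₀) y (Hy-row r₀) (h-xor-row-even zero (suc zero) r₀)
  x-parity : par (count x) ≡ par l
  x-parity = par-count-xor-even (λ r → H r r₀) x (Hx-col r₀) (h-xor-col-even zero (suc zero) r₀)
  l-even : par l ≡ false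
  l-even = begin
    par l                   ≡⟨ ∧-idem (par l) ⟨
    par l ∧ par l           ≡⟨ cong (par l ∧_) y-parity ⟨
    par l ∧ par (count y)   ≡⟨ par-* l (count y) ⟨
    par (l * count y)       ≡⟨ double-count-parity H y (h-xor-total zero (suc zero) (λ ())) Hy-row
                                                   (h-xor-col-even zero (suc zero)) ⟩
    false                   ∎

-- Linear squares

symbol : Bool → Fin 2
symbol false = zero
symbol true  = suc zero

symbol-xor : ∀ a b s → (symbol (a xor b) == s) ≡ (symbol a == s) xor b
symbol-xor false false zero       = refl
symbol-xor false false (suc zero) = refl
symbol-xor false true  zero       = refl
symbol-xor false true  (suc zero) = refl
symbol-xor true  false zero       = refl
symbol-xor true  false (suc zero) = refl
symbol-xor true  true  zero       = refl
symbol-xor true  true  (suc zero) = refl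

lookup-⁅1⁆-symbol : ∀ b → lookup ⁅ suc zero ⁆ (symbol b) ≡ b
lookup-⁅1⁆-symbol false = refl
lookup-⁅1⁆-symbol true  = refl

linear : ∀ {n} → (Fin n → Bool) → (Fin n → Bool) → Square n
linear u w r c = symbol (u r xor w c)

linear-== : ∀ {n} (u w : Fin n → Bool) r c s → (linear u w r c == s) ≡ (symbol (w c) == s) xor u r
linear-== u w r c s = trans (cong (λ t → symbol t == s) (xor-comm (u r) (w c))) (symbol-xor (w c) (u r) s)

linear-frequency : ∀ {l} (u w : Fin (2 * l) → Bool) → count u ≡ l → count w ≡ l →
  IsFrequencySquare l (linear u w)
linear-frequency u w u-bal w-bal =
  (λ r s → trans (count-cong (λ c → symbol-xor (u r) (w c) s)) (balanced-xor (symbol (u r) == s) w w-bal)) ,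
  (λ c s → trans (count-cong (λ r → linear-== u w r c s)) (balanced-xor (symbol (w c) == s) u u-bal))

EachPairOccurs : ∀ {n} → ℕ → (Fin n → Bool) → (Fin n → Bool) → Set
EachPairOccurs m u v = ∀ α β → count (λ i → (α xor u i) ∧ (β xor v i)) ≡ m

2l*m≡l*l : ∀ {l m} → m + m ≡ l → 2 * l * m ≡ l * l
2l*m≡l*l {m = m} refl = identity m
  where
  identity : ∀ m → 2 * (m + m) * m ≡ (m + m) * (m + m)
  identity = solve-∀

linear-orthogonal-rowwise : ∀ {l m} → m + m ≡ l → (u w u′ w′ : Fin (2 * l) → Bool) →
  EachPairOccurs m w w′ → Orthogonal l (linear u w) (linear u′ w′)
linear-orthogonal-rowwise {l} {m} m+m≡l u w u′ w′ occurs s t =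
  trans (count2-rows m (λ r c → (linear u w r c == s) ∧ (linear u′ w′ r c == t)) row)
        (2l*m≡l*l m+m≡l)
  where
  row : ∀ r → count (λ c → (linear u w r c == s) ∧ (linear u′ w′ r c == t)) ≡ m
  row r = trans (count-cong (λ c → cong₂ _∧_ (symbol-xor (u r) (w c) s) (symbol-xor (u′ r) (w′ c) t)))
                (occurs (symbol (u r) == s) (symbol (u′ r) == t))

linear-orthogonal-columnwise : ∀ {l m} → m + m ≡ l → (u w u′ w′ : Fin (2 * l) → Bool) →
  EachPairOccurs m u u′ → Orthogonal l (linear u w) (linear u′ w′)
linear-orthogonal-columnwise {l} {m} m+m≡l u w u′ w′ occurs s t =
  trans (count2-transpose (λ r c → (linear u w r c == s) ∧ (linear u′ w′ r c == t)))
        (trans (count2-rows m (λ c r → (linear u w r c == s) ∧ (linear u′ w′ r c == t)) column)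
               (2l*m≡l*l m+m≡l))
  where
  column : ∀ c → count (λ r → (linear u w r c == s) ∧ (linear u′ w′ r c == t)) ≡ m
  column c = trans (count-cong (λ r → cong₂ _∧_ (linear-== u w r c s) (linear-== u′ w′ r c t)))
                   (occurs (symbol (w c) == s) (symbol (w′ c) == t))

orthogonal-sym : ∀ {l} (F G : Square (2 * l)) → Orthogonal l F G → Orthogonal l G F
orthogonal-sym F G FG s t = trans (count2-cong (λ r c → ∧-comm (G r c == s) (F r c == t))) (FG t s)

linear-HasRel : ∀ {k l} (u w : Fin k → Fin (2 * l) → Bool) →
  (∀ i → count (u i) ≡ l) → (∀ i → count (w i) ≡ l) →
  (∀ i j → i ≢ j → Orthogonal l (linear (u i) (w i)) (linear (u j) (w j))) →
  HasRel k l (count (λ r → xorAll (λ i → u i r))) (count (λ c → xorAll (λ i → w i c)))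
linear-HasRel {k} {l} u w u-bal w-bal orthogonal =
  M , R , (λ _ → (λ ()) , (λ ())) , card-tabulate X , card-tabulate Y
  where
  X Y : Fin (2 * l) → Bool
  X r = xorAll (λ i → u i r)
  Y c = xorAll (λ i → w i c)
  M : MOFS k l
  M = record
    { sq    = λ i → linear (u i) (w i)
    ; freq  = λ i → linear-frequency (u i) (w i) (u-bal i) (w-bal i)
    ; ortho = orthogonal }
  even : ∀ r c → par (ind (lookup (tabulate X) r) + ind (lookup (tabulate Y) c) +
                      sumFin (λ i → ind (lookup ⁅ suc zero ⁆ (symbol (u i r xor w i c))))) ≡ false
  even r c = begin
    par (ind (lookup (tabulate X) r) + ind (lookup (tabulate Y) c) +
         sumFin (λ i → ind (lookup ⁅ suc zero ⁆ (symbol (u i r xor w i c)))))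
      ≡⟨ cong par (cong₂ _+_ (cong₂ _+_ (cong ind (lookup∘tabulate X r)) (cong ind (lookup∘tabulate Y c)))
                              (sumFin-cong {k} (λ i → cong ind (lookup-⁅1⁆-symbol (u i r xor w i c))))) ⟩
    par (ind (X r) + ind (Y c) + sumFin (λ i → ind (u i r xor w i c)))
      ≡⟨ par-relation (X r) (Y c) (λ i → u i r xor w i c) ⟩
    (X r xor Y c) xor xorAll (λ i → u i r xor w i c)
      ≡⟨ cong ((X r xor Y c) xor_) (xorAll-xor (λ i → u i r) (λ i → w i c)) ⟩
    (X r xor Y c) xor (X r xor Y c)
      ≡⟨ xor-same (X r xor Y c) ⟩
    false ∎
    where open ≡-Reasoning
  R : Relation M
  R = record
    { X₁   = tabulate X
    ; X₂   = tabulate Y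
    ; Xs   = λ _ → ⁅ suc zero ⁆
    ; even = λ r c → par≡false⇒∣ _ (even r c) }

pairwise₂ : ∀ {l} (F : Fin 2 → Square (2 * l)) → Orthogonal l (F zero) (F (suc zero)) →
  ∀ i j → i ≢ j → Orthogonal l (F i) (F j)
pairwise₂ {l} F o₀₁ zero       zero       0≢0 = ⊥-elim (0≢0 refl)
pairwise₂ {l} F o₀₁ zero       (suc zero) _   = o₀₁
pairwise₂ {l} F o₀₁ (suc zero) zero       _   = orthogonal-sym {l} (F zero) (F (suc zero)) o₀₁
pairwise₂ {l} F o₀₁ (suc zero) (suc zero) 1≢1 = ⊥-elim (1≢1 refl)

pairwise₃ : ∀ {l} (F : Fin 3 → Square (2 * l)) →
  Orthogonal l (F zero) (F (suc zero)) → Orthogonal l (F zero) (F (suc (suc zero))) →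
  Orthogonal l (F (suc zero)) (F (suc (suc zero))) →
  ∀ i j → i ≢ j → Orthogonal l (F i) (F j)
pairwise₃ {l} F o₀₁ o₀₂ o₁₂ zero             zero             i≢i = ⊥-elim (i≢i refl)
pairwise₃ {l} F o₀₁ o₀₂ o₁₂ zero             (suc zero)       _   = o₀₁
pairwise₃ {l} F o₀₁ o₀₂ o₁₂ zero             (suc (suc zero)) _   = o₀₂
pairwise₃ {l} F o₀₁ o₀₂ o₁₂ (suc zero)       zero             _   = orthogonal-sym {l} (F zero) (F (suc zero)) o₀₁
pairwise₃ {l} F o₀₁ o₀₂ o₁₂ (suc zero)       (suc zero)       i≢i = ⊥-elim (i≢i refl)
pairwise₃ {l} F o₀₁ o₀₂ o₁₂ (suc zero)       (suc (suc zero)) _   = o₁₂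
pairwise₃ {l} F o₀₁ o₀₂ o₁₂ (suc (suc zero)) zero             _   = orthogonal-sym {l} (F zero) (F (suc (suc zero))) o₀₂
pairwise₃ {l} F o₀₁ o₀₂ o₁₂ (suc (suc zero)) (suc zero)       _   = orthogonal-sym {l} (F (suc zero)) (F (suc (suc zero))) o₁₂
pairwise₃ {l} F o₀₁ o₀₂ o₁₂ (suc (suc zero)) (suc (suc zero)) i≢i = ⊥-elim (i≢i refl)

-- Vectors made of constant blocks

count-++ : ∀ {A : Set} {m n} (P : A → Bool) (xs : Vector A m) (ys : Vector A n) →
  count (λ i → P ((xs ++ᵛ ys) i)) ≡ count (λ i → P (xs i)) + count (λ i → P (ys i))
count-++ {m = zero}  P xs ys = refl
count-++ {m = suc m} P xs ys =
  trans (cong (ind (P (xs zero)) +_)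
              (trans (count-cong (λ i → cong P ([,]-map (splitAt m i)))) (count-++ P (λ i → xs (suc i)) ys)))
        (sym (+-assoc (ind (P (xs zero))) _ _))

count-cast : ∀ {m n} (eq : m ≡ n) (p : Fin n → Bool) → count (λ i → p (cast eq i)) ≡ count p
count-cast {zero}  refl p = refl
count-cast {suc m} refl p = cong (ind (p zero) +_) (count-cast {m} refl (λ i → p (suc i)))

Runs : Set → Set
Runs A = List (ℕ × A)

countRuns : ∀ {A : Set} → (A → Bool) → Runs A → ℕ
countRuns P []             = 0
countRuns P ((s , t) ∷ Rs) = (if P t then s else 0) + countRuns P Rs

runsLength : ∀ {A : Set} → Runs A → ℕ
runsLength = countRuns (λ _ → true)

blocks : ∀ {A : Set} (Rs : Runs A) → Vector A (runsLength Rs)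
blocks []             = []ᵛ
blocks ((s , t) ∷ Rs) = replicate s t ++ᵛ blocks Rs

count-blocks : ∀ {A : Set} (P : A → Bool) (Rs : Runs A) → count (λ i → P (blocks Rs i)) ≡ countRuns P Rs
count-blocks P []             = refl
count-blocks P ((s , t) ∷ Rs) =
  trans (count-++ P (replicate s t) (blocks Rs)) (cong₂ _+_ (count-const (P t)) (count-blocks P Rs))

runsVector : ∀ {A : Set} {n} (Rs : Runs A) → n ≡ runsLength Rs → Fin n → A
runsVector Rs eq i = blocks Rs (cast eq i)

count-runsVector : ∀ {A : Set} {n} (P : A → Bool) (Rs : Runs A) (eq : n ≡ runsLength Rs) →
  count (λ i → P (runsVector Rs eq i)) ≡ countRuns P Rs
count-runsVector P Rs eq = trans (count-cast eq (λ j → P (blocks Rs j))) (count-blocks P Rs)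

pairRuns : ℕ → ℕ → Runs (Bool × Bool)
pairRuns j j′ = (j , true , false) ∷ (j , false , true) ∷ (j′ , true , true) ∷ (j′ , false , false) ∷ []

doubled : ∀ a b → a + (a + (b + (b + 0))) ≡ (a + b) + (a + b)
doubled = solve-∀

module Pair {l j j′ : ℕ} (j+j′≡l : j + j′ ≡ l) where

  runs : Runs (Bool × Bool)
  runs = pairRuns j j′

  length : 2 * l ≡ runsLength runs
  length = sym (trans (doubled j j′) (trans (cong₂ _+_ j+j′≡l j+j′≡l) (sym (2*l≡l+l l))))

  vectors : Fin 2 → Fin (2 * l) → Bool
  vectors zero       r = proj₁ (runsVector runs length r)
  vectors (suc zero) r = proj₂ (runsVector runs length r)

  balanced : ∀ i → count (vectors i) ≡ l
  balanced zero       = trans (count-runsVector proj₁ runs length) (trans (j+[j′+0]≡j+j′ j j′) j+j′≡l)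
  balanced (suc zero) = trans (count-runsVector proj₂ runs length) (trans (j+[j′+0]≡j+j′ j j′) j+j′≡l)

  xor-count : count (λ r → xorAll (λ i → vectors i r)) ≡ 2 * j
  xor-count = count-runsVector (λ t → proj₁ t xor (proj₂ t xor false)) runs length

module EvenPair {l m : ℕ} (m+m≡l : m + m ≡ l) where
  open Pair {l} {m} {m} m+m≡l public

  occurs : EachPairOccurs m (vectors zero) (vectors (suc zero))
  occurs α β = trans (count-runsVector (λ t → (α xor proj₁ t) ∧ (β xor proj₂ t)) runs length) (one-run α β)
    where
    one-run : ∀ α β → countRuns (λ t → (α xor proj₁ t) ∧ (β xor proj₂ t)) runs ≡ m
    one-run false false = +-identityʳ m
    one-run false true  = +-identityʳ m
    one-run true  false = +-identityʳ m
    one-run true  true  = +-identityʳ m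

record BoundedSplit (m j : ℕ) : Set where
  field
    p p′ q q′ : ℕ
    p+p′≡m : p + p′ ≡ m
    q+q′≡m : q + q′ ≡ m
    p+q′≡j : p + q′ ≡ j

boundedSplit : ∀ m j → j ≤ m + m → BoundedSplit m j
boundedSplit m j j≤m+m with j ≤? m
... | yes j≤m = record
  { p = j ; p′ = m ∸ j ; q = m ; q′ = 0
  ; p+p′≡m = m+[n∸m]≡n j≤m ; q+q′≡m = +-identityʳ m ; p+q′≡j = +-identityʳ j }
... | no j≰m = record
  { p = m ; p′ = 0 ; q = m ∸ (j ∸ m) ; q′ = j ∸ m
  ; p+p′≡m = +-identityʳ m
  ; q+q′≡m = m∸n+n≡m (m≤n+o⇒m∸n≤o j m j≤m+m)
  ; p+q′≡j = m+[n∸m]≡n (<⇒≤ (≰⇒> j≰m)) }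

tripleRuns : ℕ → ℕ → ℕ → ℕ → Runs (Bool × Bool × Bool)
tripleRuns p p′ q q′ =
  List.map (map₂ (false ,_)) (pairRuns p p′) List.++ List.map (map₂ (true ,_)) (pairRuns q q′)

module Triple {l m j : ℕ} (m+m≡l : m + m ≡ l) (split : BoundedSplit m j) where
  open BoundedSplit split

  runs : Runs (Bool × Bool × Bool)
  runs = tripleRuns p p′ q q′

  length : 2 * l ≡ runsLength runs
  length = sym (begin
    p + (p + (p′ + (p′ + (q + (q + (q′ + (q′ + 0)))))))   ≡⟨ identity p p′ q q′ ⟩
    ((p + p′) + (p + p′)) + ((q + q′) + (q + q′))         ≡⟨ cong₂ (λ a b → (a + a) + (b + b)) p+p′≡m q+q′≡m ⟩
    (m + m) + (m + m)                                     ≡⟨ cong₂ _+_ m+m≡l m+m≡l ⟩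
    l + l                                                 ≡⟨ 2*l≡l+l l ⟨
    2 * l                                                 ∎)
    where
    open ≡-Reasoning
    identity : ∀ p p′ q q′ →
      p + (p + (p′ + (p′ + (q + (q + (q′ + (q′ + 0))))))) ≡ ((p + p′) + (p + p′)) + ((q + q′) + (q + q′))
    identity = solve-∀

  both-halves : p + (p′ + (q + (q′ + 0))) ≡ l
  both-halves = trans (identity p p′ q q′) (trans (cong₂ _+_ p+p′≡m q+q′≡m) m+m≡l)
    where
    identity : ∀ a b c d → a + (b + (c + (d + 0))) ≡ (a + b) + (c + d)
    identity = solve-∀

  half-length : ∀ α → (if α then p + (p′ + 0) else q + (q′ + 0)) ≡ m
  half-length true  = trans (j+[j′+0]≡j+j′ p p′) p+p′≡m
  half-length false = trans (j+[j′+0]≡j+j′ q q′) q+q′≡m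

  vectors : Fin 3 → Fin (2 * l) → Bool
  vectors zero             r = proj₁ (runsVector runs length r)
  vectors (suc zero)       r = proj₁ (proj₂ (runsVector runs length r))
  vectors (suc (suc zero)) r = proj₂ (proj₂ (runsVector runs length r))

  balanced : ∀ i → count (vectors i) ≡ l
  balanced zero = begin
    count (vectors zero)               ≡⟨ count-runsVector proj₁ runs length ⟩
    q + (q + (q′ + (q′ + 0)))          ≡⟨ doubled q q′ ⟩
    (q + q′) + (q + q′)                ≡⟨ cong₂ _+_ q+q′≡m q+q′≡m ⟩
    m + m                              ≡⟨ m+m≡l ⟩
    l                                  ∎
    where open ≡-Reasoning
  balanced (suc zero) = trans (count-runsVector (λ t → proj₁ (proj₂ t)) runs length) both-halves
  balanced (suc (suc zero)) = trans (count-runsVector (λ t → proj₂ (proj₂ t)) runs length) both-halves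

  xor-count : count (λ r → xorAll (λ i → vectors i r)) ≡ 2 * j
  xor-count = begin
    count (λ r → xorAll (λ i → vectors i r))
      ≡⟨ count-runsVector (λ t → proj₁ t xor (proj₁ (proj₂ t) xor (proj₂ (proj₂ t) xor false))) runs length ⟩
    p + (p + (q′ + (q′ + 0)))      ≡⟨ identity p q′ ⟩
    2 * (p + q′)                   ≡⟨ cong (2 *_) p+q′≡j ⟩
    2 * j                          ∎
    where
    open ≡-Reasoning
    identity : ∀ p q′ → p + (p + (q′ + (q′ + 0))) ≡ 2 * (p + q′)
    identity = solve-∀

  occurs₀₁ : EachPairOccurs m (vectors zero) (vectors (suc zero))
  occurs₀₁ α β = trans (count-runsVector (λ t → (α xor proj₁ t) ∧ (β xor proj₁ (proj₂ t))) runs length)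
                       (trans (one-half α β) (half-length α))
    where
    one-half : ∀ α β → countRuns (λ t → (α xor proj₁ t) ∧ (β xor proj₁ (proj₂ t))) runs
                     ≡ (if α then p + (p′ + 0) else q + (q′ + 0))
    one-half false false = refl
    one-half false true  = refl
    one-half true  false = refl
    one-half true  true  = refl

  occurs₀₂ : EachPairOccurs m (vectors zero) (vectors (suc (suc zero)))
  occurs₀₂ α β = trans (count-runsVector (λ t → (α xor proj₁ t) ∧ (β xor proj₂ (proj₂ t))) runs length)
                       (trans (one-half α β) (half-length α))
    where
    one-half : ∀ α β → countRuns (λ t → (α xor proj₁ t) ∧ (β xor proj₂ (proj₂ t))) runs
                     ≡ (if α then p + (p′ + 0) else q + (q′ + 0))
    one-half false false = refl
    one-half false true  = refl
    one-half true  false = refl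
    one-half true  true  = refl

-- Sufficiency

sufficient₁ : ∀ l → HasRel 1 l l l
sufficient₁ l = subst₂ (HasRel 1 l) xor-count xor-count
  (linear-HasRel (λ _ → v) (λ _ → v) (λ _ → balanced zero) (λ _ → balanced zero)
                 (λ { zero zero 0≢0 → ⊥-elim (0≢0 refl) }))
  where
  open Pair {l} {l} {0} (+-identityʳ l) using (vectors; balanced)
  v : Fin (2 * l) → Bool
  v = vectors zero
  xor-count : count (λ r → v r xor false) ≡ l
  xor-count = trans (count-cong (λ r → xor-identityʳ (v r))) (balanced zero)

pairs-HasRel : ∀ {l m j j′} → m + m ≡ l → j + j′ ≡ l → HasRel 2 l l (2 * j) × HasRel 2 l (2 * j) l
pairs-HasRel {l} {m} {j} {j′} m+m≡l j+j′≡l =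
  subst₂ (HasRel 2 l) U-xor W.xor-count
    (linear-HasRel U.vectors W.vectors U.balanced W.balanced
      (pairwise₂ {l} (λ i → linear (U.vectors i) (W.vectors i))
        (linear-orthogonal-columnwise m+m≡l (U.vectors zero) (W.vectors zero)
                                       (U.vectors (suc zero)) (W.vectors (suc zero)) U.occurs))) ,
  subst₂ (HasRel 2 l) W.xor-count U-xor
    (linear-HasRel W.vectors U.vectors W.balanced U.balanced
      (pairwise₂ {l} (λ i → linear (W.vectors i) (U.vectors i))
        (linear-orthogonal-rowwise m+m≡l (W.vectors zero) (U.vectors zero)
                                    (W.vectors (suc zero)) (U.vectors (suc zero)) U.occurs)))
  where
  module U = EvenPair {l} {m} m+m≡l
  module W = Pair {l} {j} {j′} j+j′≡l
  U-xor : count (λ r → xorAll (λ i → U.vectors i r)) ≡ l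
  U-xor = trans U.xor-count (trans (2*l≡l+l m) m+m≡l)

triples-HasRel : ∀ {l m j j′} → m + m ≡ l → BoundedSplit m j → BoundedSplit m j′ →
  HasRel 3 l (2 * j) (2 * j′)
triples-HasRel {l} {m} {j} {j′} m+m≡l split split′ =
  subst₂ (HasRel 3 l) U.xor-count W-xor
    (linear-HasRel U.vectors W U.balanced W-balanced
      (pairwise₃ {l} (λ i → linear (U.vectors i) (W i))
        (linear-orthogonal-columnwise m+m≡l (U.vectors zero) (W zero) (U.vectors (suc zero)) (W (suc zero))
                                       U.occurs₀₁)
        (linear-orthogonal-columnwise m+m≡l (U.vectors zero) (W zero)
                                       (U.vectors (suc (suc zero))) (W (suc (suc zero))) U.occurs₀₂)
        (linear-orthogonal-rowwise m+m≡l (U.vectors (suc zero)) (W (suc zero))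
                                    (U.vectors (suc (suc zero))) (W (suc (suc zero))) V.occurs₀₂)))
  where
  module U = Triple {l} {m} m+m≡l split
  module V = Triple {l} {m} m+m≡l split′
  -- V with its first two vectors exchanged, so that W₁ = V₀ and W₂ = V₂ are equidistributed.
  W : Fin 3 → Fin (2 * l) → Bool
  W zero             = V.vectors (suc zero)
  W (suc zero)       = V.vectors zero
  W (suc (suc zero)) = V.vectors (suc (suc zero))
  W-balanced : ∀ i → count (W i) ≡ l
  W-balanced zero             = V.balanced (suc zero)
  W-balanced (suc zero)       = V.balanced zero
  W-balanced (suc (suc zero)) = V.balanced (suc (suc zero))
  W-xor : count (λ c → xorAll (λ i → W i c)) ≡ 2 * j′
  W-xor = trans (count-cong (λ c → xor-x∙yz≈y∙xz (W zero c) (W (suc zero) c) _)) V.xor-count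

halve : ∀ {n} → 2 ∣ n → Σ ℕ λ h → 2 * h ≡ n
halve (divides h refl) = h , *-comm 2 h

half-≤ : ∀ {j} m → 2 * j ≤ 2 * (2 * m) → j ≤ m + m
half-≤ {j} m le = subst (j ≤_) (2*l≡l+l m) (*-cancelˡ-≤ 2 le)

sufficient₂ : ∀ {l b} → 2 ∣ l → 2 ∣ b → b ≤ 2 * l → HasRel 2 l l b × HasRel 2 l b l
sufficient₂ 2∣l 2∣b b≤2l with halve 2∣l | halve 2∣b
... | m , refl | j , refl =
  pairs-HasRel {2 * m} {m} {j} {2 * m ∸ j} (sym (2*l≡l+l m)) (m+[n∸m]≡n (*-cancelˡ-≤ {j} {2 * m} 2 b≤2l))

sufficient₃ : ∀ {l a b} → 2 ∣ l → 2 ∣ a → 2 ∣ b → a ≤ 2 * l → b ≤ 2 * l → HasRel 3 l a b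
sufficient₃ 2∣l 2∣a 2∣b a≤2l b≤2l with halve 2∣l | halve 2∣a | halve 2∣b
... | m , refl | j , refl | j′ , refl =
  triples-HasRel {2 * m} {m} (sym (2*l≡l+l m))
    (boundedSplit m j (half-≤ m a≤2l)) (boundedSplit m j′ (half-≤ m b≤2l))

someRow : (l : ℕ) → .{{NonZero l}} → Fin (2 * l)
someRow (suc l) = zero

theorem2p7 : (l : ℕ) → .{{_ : NonZero l}} → (a b : ℕ) → a ≤ 2 * l → b ≤ 2 * l →
    (HasRel 1 l a b ⇔ (a ≡ l × b ≡ l)) ×
    (HasRel 2 l a b ⇔ ((2 ∣ l × 2 ∣ a × 2 ∣ b) × (a ≡ l ⊎ b ≡ l))) ×
    (HasRel 3 l a b ⇔ (2 ∣ l × 2 ∣ a × 2 ∣ b))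
theorem2p7 l a b a≤2l b≤2l =
  mk⇔ (necessary₁ (someRow l)) (λ (a≡l , b≡l) → subst₂ (HasRel 1 l) (sym a≡l) (sym b≡l) (sufficient₁ l)) ,
  mk⇔ (necessary₂ (someRow l)) from₂ ,
  mk⇔ (necessary₃ (someRow l)) (λ (2∣l , 2∣a , 2∣b) → sufficient₃ 2∣l 2∣a 2∣b a≤2l b≤2l)
  where
  from₂ : (2 ∣ l × 2 ∣ a × 2 ∣ b) × (a ≡ l ⊎ b ≡ l) → HasRel 2 l a b
  from₂ ((2∣l , _ , 2∣b) , inj₁ a≡l) = subst (λ a → HasRel 2 l a b) (sym a≡l) (proj₁ (sufficient₂ 2∣l 2∣b b≤2l))
  from₂ ((2∣l , 2∣a , _) , inj₂ b≡l) = subst (HasRel 2 l a) (sym b≡l) (proj₂ (sufficient₂ 2∣l 2∣a a≤2l))
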